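{- Let $G=(V,E)$ be a connected graph and $T=\{t_1,\dots,t_k\}\subseteq V$ a set of terminals. Define $C^r_1,\dots,C^r_k$ inductively: $C^r_i$ is the connected component containing $t_i$ of the graph $G-\big(C^r_1\cup\dots\cup C^r_{i-1}\cup\{t_{i+1},\dots,t_k\}\big)$. Then $\{C^r_1,\dots,C^r_k\}$ is a partition of $V$ into connected sets with $t_i\in C^r_i$, and the set $R$ of edges of $G$ joining vertices in different sets $C^r_i$, $C^r_j$ ($i\neq j$) is a minimal edge multiway cut of $(G,T)$.
   Context: Graphs are finite, undirected, connected, without self-loops or parallel edges. An edge multiway cut of $(G,T)$ is a set $M\subseteq E$ such that in $G-M$ no two distinct terminals are joined by a path; it is minimal if no proper subset is an edge multiway cut. Minimal edge multiway cuts correspond bijectively to partitions $\{C_1,\dots,C_k\}$ of $V$ with each $G[C_i]$ connected and $t_i\in C_i$ (the cut being the edges between different parts); $R$ is called the root. -}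

module Defs where

open import Data.Nat using (ℕ)
open import Data.Fin using (Fin; _<_)
open import Data.Product using (Σ; ∃; _×_; _,_)
open import Data.Empty using (⊥)
open import Relation.Nullary using (¬_)
open import Relation.Binary using (Decidable)
open import Relation.Binary.PropositionalEquality using (_≡_; _≢_)
open import Function.Definitions using (Injective)

record SimpleGraph (n : ℕ) : Set₁ where
  field
    Adj     : Fin n → Fin n → Set
    adj?    : Decidable Adj
    sym     : ∀ {u v} → Adj u v → Adj v u
    irrefl  : ∀ {u} → ¬ Adj u u

VSet : ℕ → Set₁
VSet n = Fin n → Set

-- Edge sets as predicates on (ordered) vertex pairs; see IsEdgeSet.
ESet : ℕ → Set₁
ESet n = Fin n → Fin n → Set

data Walk {n : ℕ} (Step : Fin n → Fin n → Set) (S : VSet n) : Fin n → Fin n → Set where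
  here : ∀ {u} → S u → Walk Step S u u
  step : ∀ {u v w} → S u → Step u v → Walk Step S v w → Walk Step S u w

module _ {n : ℕ} (G : SimpleGraph n) where
  open SimpleGraph G

  everything : VSet n
  everything _ = Data.Unit.⊤
    where import Data.Unit

  Connected : Set
  Connected = ∀ u v → Walk Adj (λ _ → Data.Unit.⊤) u v
    where import Data.Unit

  ConnectedSet : VSet n → Set
  ConnectedSet S = ∀ u v → S u → S v → Walk Adj S u v

  -- C is (the vertex set of) the connected component of G[S] containing t
  -- (empty if t ∉ S).
  IsComponentOf : VSet n → Fin n → VSet n → Set
  IsComponentOf S t C = ∀ v → (C v → Walk Adj S t v) × (Walk Adj S t v → C v)

  IsEdgeSet : ESet n → Set
  IsEdgeSet M = (∀ u v → M u v → Adj u v) × (∀ u v → M u v → M v u)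

  AdjMinus : ESet n → Fin n → Fin n → Set
  AdjMinus M u v = Adj u v × ¬ M u v

  -- Edge multiway cut of (G, T) with T = image of t.
  IsMultiwayCut : ∀ {k} → (Fin k → Fin n) → ESet n → Set
  IsMultiwayCut t M =
    IsEdgeSet M ×
    (∀ i j → i ≢ j → ¬ Walk (AdjMinus M) (λ _ → Data.Unit.⊤) (t i) (t j))
    where import Data.Unit

  IsMinimalMultiwayCut : ∀ {k} → (Fin k → Fin n) → ESet n → Set₁
  IsMinimalMultiwayCut t M =
    IsMultiwayCut t M ×
    (∀ (M' : ESet n) → IsEdgeSet M' → (∀ u v → M' u v → M u v) →
       (Σ (Fin n) λ u → Σ (Fin n) λ v → M u v × ¬ M' u v) →
       ¬ IsMultiwayCut t M')

  RemainingAt : ∀ {k} → (Fin k → Fin n) → (Fin k → VSet n) → Fin k → VSet n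
  RemainingAt t C i v =
    ¬ (Σ (Fin _) λ j → j < i × C j v) × ¬ (Σ (Fin _) λ j → i < j × t j ≡ v)

  IsRootFamily : ∀ {k} → (Fin k → Fin n) → (Fin k → VSet n) → Set
  IsRootFamily t C = ∀ i → IsComponentOf (RemainingAt t C i) (t i) (C i)

  IsTerminalPartition : ∀ {k} → (Fin k → Fin n) → (Fin k → VSet n) → Set
  IsTerminalPartition t C =
    (∀ v → ∃ λ i → C i v) ×
    (∀ v i j → C i v → C j v → i ≡ j) ×
    (∀ i → ConnectedSet (C i)) ×
    (∀ i → C i (t i))

  CutEdges : ∀ {k} → (Fin k → VSet n) → ESet n
  CutEdges C u v = Adj u v × (Σ _ λ i → Σ _ λ j → i ≢ j × C i u × C j v)

-- (1) Every partition {C_1,…,C_k} of V into connected parts with t_i ∈ C_i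
--     induces a minimal multiway cut, namely the set of edges between parts:
--     a walk avoiding those edges never leaves its part, so terminals are
--     separated; and if some cut edge uv with u ∈ C_i, v ∈ C_j is spared,
--     then t_i ⇝ u → v ⇝ t_j is a walk inside C_i ∪ C_j avoiding the smaller
--     cut, since each part is connected and contains no cut edge.
--
-- (2) The root family C^r is such a partition.  Each C^r_i is a connected
--     component of G[S] for some S, hence connected, closed under
--     S-adjacency and inside S; injectivity of t puts t_i in C^r_i; and
--     C^r_j ⊆ V ∖ C^r_i for i < j gives disjointness.  Coverage is the only
--     non-local point: if v lies in no part, a walk from v to a terminal
--     has a first edge ab entering ⋃ C^r, with b ∈ C^r_j; then a lies in the
--     vertex set from which C^r_j was taken, so a ∈ C^r_j — a contradiction.
--     Turning "not uncovered" into an actual part requires membership in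
--     C^r_j to be decidable, which follows from decidability of walks in a
--     finite graph (a depth-first search by well-founded recursion on the
--     set of allowed vertices).
module Submission where

open import Defs
open import Data.Nat using (ℕ; _≤_)
open import Data.Fin using (Fin; _<_; fromℕ<)
open import Data.Fin.Properties using (_≟_; _<?_; <-cmp; <-irrefl; any?)
open import Data.Fin.Induction using (<-wellFounded)
open import Data.Fin.Subset using (Subset; _∈_; _⊂_)
open import Data.Fin.Subset.Induction using (⊂-wellFounded)
open import Data.Vec using (tabulate)
open import Data.Vec.Properties using (lookup∘tabulate; lookup⇒[]=; []=⇒lookup)
open import Data.Product using (Σ; ∃; ∃₂; _×_; _,_; proj₁; proj₂)
open import Data.Sum using (_⊎_; inj₁; inj₂; [_,_]′)
open import Data.Unit using (⊤; tt)
open import Data.Empty using (⊥-elim)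
open import Function using (_∘_)
open import Function.Definitions using (Injective)
open import Induction.WellFounded using (Acc; acc)
open import Relation.Binary using (tri<; tri≈; tri>)
import Relation.Binary as B
import Relation.Unary as U
open import Relation.Nullary using (¬_; Dec; yes; no; does)
open import Relation.Nullary.Decidable using (_×-dec_; map′; ¬?; dec-true; decidable-stable)
open import Relation.Binary.PropositionalEquality using (_≡_; _≢_; refl; sym; trans; subst)

module _ {n : ℕ} {R : Fin n → Fin n → Set} {S : VSet n} where

  start : ∀ {u v} → Walk R S u v → S u
  start (here Su)     = Su
  start (step Su _ _) = Su

  end : ∀ {u v} → Walk R S u v → S v
  end (here Sv)    = Sv
  end (step _ _ p) = end p

  _++_ : ∀ {u v w} → Walk R S u v → Walk R S v w → Walk R S u w
  here _     ++ q = q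
  step s r p ++ q = step s r (p ++ q)

  reverse : (∀ {x y} → R x y → R y x) → ∀ {u v} → Walk R S u v → Walk R S v u
  reverse sym-R (here Su)     = here Su
  reverse sym-R (step Su r p) = reverse sym-R p ++ step (start p) (sym-R r) (here Su)

  mapWalk : ∀ {R′ : Fin n → Fin n → Set} {S′ : VSet n} →
            (∀ {x y} → S x → S y → R x y → R′ x y) → (∀ {x} → S x → S′ x) →
            ∀ {u v} → Walk R S u v → Walk R′ S′ u v
  mapWalk f g (here Su)     = here (g Su)
  mapWalk f g (step Su r p) = step (g Su) (f Su (start p) r) (mapWalk f g p)

  enteringStep : {Q : VSet n} → U.Decidable Q → ∀ {u v} → Walk R S u v →
                 ¬ Q u → Q v → ∃₂ λ a b → ¬ Q a × R a b × Q b
  enteringStep Q? (here _) ¬Qu Qv = ⊥-elim (¬Qu Qv)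
  enteringStep Q? (step {v = w} _ r p) ¬Qu Qv with Q? w
  ... | yes Qw  = _ , _ , ¬Qu , r , Qw
  ... | no ¬Qw  = enteringStep Q? p ¬Qw Qv

-- Walks are decided by depth-first search, recursing on ever smaller
-- vertex sets.  S ∖ s is S with the vertex s removed.
_∖_ : ∀ {n} → VSet n → Fin n → VSet n
(S ∖ s) x = S x × x ≢ s

_∖?_ : ∀ {n} {S : VSet n} → U.Decidable S → (s : Fin n) → U.Decidable (S ∖ s)
(S? ∖? s) x = S? x ×-dec ¬? (x ≟ s)

lastExit : ∀ {n} {R : Fin n → Fin n → Set} {S : VSet n} (s : Fin n) {x v} →
           s ≢ v → Walk R S x v →
           Walk R (S ∖ s) x v ⊎ (∃ λ u → R s u × Walk R (S ∖ s) u v)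
lastExit s s≢v (here Sv) = inj₁ (here (Sv , s≢v ∘ sym))
lastExit s s≢v (step {u = x} Sx r p) with lastExit s s≢v p
... | inj₂ afterS = inj₂ afterS
... | inj₁ p′ with x ≟ s
...   | yes refl = inj₂ (_ , r , p′)
...   | no x≢s   = inj₁ (step (Sx , x≢s) r p′)

-- The finite set of vertices satisfying a decidable predicate; it serves as
-- the termination measure of the search below.
members : ∀ {n} {S : VSet n} → U.Decidable S → Subset n
members S? = tabulate (does ∘ S?)

module _ {n : ℕ} {S : VSet n} (S? : U.Decidable S) where

  ∈-members⁺ : ∀ {x} → S x → x ∈ members S?
  ∈-members⁺ {x} Sx =
    lookup⇒[]= x (members S?) (trans (lookup∘tabulate (does ∘ S?) x) (dec-true (S? x) Sx))

  ∈-members⁻ : ∀ {x} → x ∈ members S? → S x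
  ∈-members⁻ {x} x∈ with S? x | trans (sym (lookup∘tabulate (does ∘ S?) x)) ([]=⇒lookup x∈)
  ... | yes Sx | _ = Sx
  ... | no _   | ()

members-∖ : ∀ {n} {S : VSet n} (S? : U.Decidable S) {s} → S s → members (S? ∖? s) ⊂ members S?
members-∖ S? {s} Ss =
    (λ x∈ → ∈-members⁺ S? (proj₁ (∈-members⁻ (S? ∖? s) x∈)))
  , s , ∈-members⁺ S? Ss , (λ s∈ → proj₂ (∈-members⁻ (S? ∖? s) s∈) refl)

module _ {n : ℕ} {R : Fin n → Fin n → Set} (R? : B.Decidable R) where

  -- Depth-first search: a walk from s ≠ v exists iff some neighbour u of s
  -- reaches v without revisiting s (by lastExit).
  private
    search : ∀ {S : VSet n} (S? : U.Decidable S) → Acc _⊂_ (members S?) →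
             ∀ s v → Dec (Walk R S s v)
    search S? (acc smaller) s v with S? s | s ≟ v
    ... | no ¬Ss | _        = no (¬Ss ∘ start)
    ... | yes Ss | yes refl = yes (here Ss)
    ... | yes Ss | no s≢v
      with any? (λ u → R? s u ×-dec search (S? ∖? s) (smaller (members-∖ S? Ss)) u v)
    ...   | yes (u , r , p) = yes (step Ss r (mapWalk (λ _ _ r′ → r′) proj₁ p))
    ...   | no stuck        =
      no λ w → [ (λ w′ → proj₂ (start w′) refl) , stuck ]′ (lastExit s s≢v w)

  walk? : ∀ {S : VSet n} → U.Decidable S → ∀ s v → Dec (Walk R S s v)
  walk? S? = search S? (⊂-wellFounded (members S?))

module Component {n : ℕ} (G : SimpleGraph n) {S : VSet n} {t : Fin n} {C : VSet n}
                 (isComp : IsComponentOf G S t C) where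
  open SimpleGraph G renaming (sym to adj-sym)

  ⊆-ambient : ∀ {v} → C v → S v
  ⊆-ambient {v} Cv = end (proj₁ (isComp v) Cv)

  closed : ∀ {a b} → C a → S b → Adj a b → C b
  closed {a} {b} Ca Sb adj =
    proj₂ (isComp b) (proj₁ (isComp a) Ca ++ step (⊆-ambient Ca) adj (here Sb))

  confine : ∀ {a b} → Walk Adj S a b → C a → Walk Adj C a b
  confine (here _)       Ca = here Ca
  confine (step _ adj p) Ca = step Ca adj (confine p (closed Ca (start p) adj))

  -- Any two vertices are joined through the root t, inside C.
  connected : ConnectedSet G C
  connected u v Cu Cv = reverse adj-sym (confine toU Ct) ++ confine (proj₁ (isComp v) Cv) Ct
    where
    toU : Walk Adj S t u
    toU = proj₁ (isComp u) Cu
    Ct : C t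
    Ct = proj₂ (isComp t) (here (start toU))

module PartitionCut {n k : ℕ} (G : SimpleGraph n) (t : Fin k → Fin n) (C : Fin k → VSet n)
                    (partition : IsTerminalPartition G t C) where
  open SimpleGraph G renaming (sym to adj-sym)

  private
    cover : ∀ v → ∃ λ i → C i v
    cover = proj₁ partition
    disjoint : ∀ v i j → C i v → C j v → i ≡ j
    disjoint = proj₁ (proj₂ partition)
    connC : ∀ i → ConnectedSet G (C i)
    connC = proj₁ (proj₂ (proj₂ partition))
    terminal : ∀ i → C i (t i)
    terminal = proj₂ (proj₂ (proj₂ partition))

  Cut : ESet n
  Cut = CutEdges G C

  uncut-samePart : ∀ {p a b} → Adj a b → ¬ Cut a b → C p a → C p b
  uncut-samePart {p} {b = b} adj ¬cut Cpa with cover b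
  ... | q , Cqb with p ≟ q
  ...   | yes refl = Cqb
  ...   | no p≢q   = ⊥-elim (¬cut (adj , p , q , p≢q , Cpa , Cqb))

  stayInPart : ∀ {S p a b} → Walk (AdjMinus G Cut) S a b → C p a → C p b
  stayInPart (here _)                 Cpa = Cpa
  stayInPart (step _ (adj , ¬cut) w) Cpa = stayInPart w (uncut-samePart adj ¬cut Cpa)

  isEdgeSet : IsEdgeSet G Cut
  isEdgeSet = (λ _ _ → proj₁)
            , λ { _ _ (adj , i , j , i≢j , Ciu , Cjv) → adj-sym adj , j , i , i≢j ∘ sym , Cjv , Ciu }

  -- Terminals lie in different parts, hence are separated.
  isMultiwayCut : IsMultiwayCut G t Cut
  isMultiwayCut = isEdgeSet , λ i j i≢j w →
    i≢j (disjoint (t j) i j (stayInPart w (terminal i)) (terminal j))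

  -- A set of cut edges never meets the inside of a part, so parts stay
  -- connected after removing it.
  partWalk : ∀ {M′ : ESet n} → (∀ u v → M′ u v → Cut u v) →
             ∀ {p x y} → C p x → C p y → Walk (AdjMinus G M′) (λ _ → ⊤) x y
  partWalk {M′} M′⊆Cut {p} Cpx Cpy = mapWalk keep (λ _ → tt) (connC p _ _ Cpx Cpy)
    where
    keep : ∀ {a b} → C p a → C p b → Adj a b → AdjMinus G M′ a b
    keep Cpa Cpb adj = adj , λ m →
      let (_ , q , r , q≢r , Cqa , Crb) = M′⊆Cut _ _ m
      in  q≢r (trans (disjoint _ q p Cqa Cpa) (disjoint _ p r Cpb Crb))

  -- Sparing a cut edge uv (u ∈ C_i, v ∈ C_j) reconnects t_i and t_j.
  isMinimal : IsMinimalMultiwayCut G t Cut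
  isMinimal = isMultiwayCut , λ { M′ _ M′⊆Cut (u , v , (adj , i , j , i≢j , Ciu , Cjv) , ¬M′uv) (_ , separates) →
    separates i j i≢j
      (partWalk M′⊆Cut (terminal i) Ciu ++ step tt (adj , ¬M′uv) (partWalk M′⊆Cut Cjv (terminal j))) }

module RootFamily {n k : ℕ} (G : SimpleGraph n) (t : Fin k → Fin n) (C : Fin k → VSet n)
                  (root : IsRootFamily G t C) where
  open SimpleGraph G renaming (sym to adj-sym)

  Rem : Fin k → VSet n
  Rem = RemainingAt G t C

  module Part (i : Fin k) = Component G (root i)

  -- A later part is built after removing all earlier ones.
  disjoint : ∀ v i j → C i v → C j v → i ≡ j
  disjoint v i j Civ Cjv with <-cmp i j
  ... | tri< i<j _ _ = ⊥-elim (proj₁ (Part.⊆-ambient j Cjv) (i , i<j , Civ))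
  ... | tri≈ _ i≡j _ = i≡j
  ... | tri> _ _ j<i = ⊥-elim (proj₁ (Part.⊆-ambient i Civ) (j , j<i , Cjv))

  -- t_i is not removed before C_i is built: it is in no earlier part
  -- (those avoid later terminals) and differs from every later terminal.
  terminal : Injective _≡_ _≡_ t → ∀ i → C i (t i)
  terminal inj i = proj₂ (root i (t i)) (here (notEarlier , notLater))
    where
    notEarlier : ¬ (Σ (Fin k) λ j → j < i × C j (t i))
    notEarlier (j , j<i , Cj) = proj₂ (Part.⊆-ambient j Cj) (i , j<i , refl)
    notLater : ¬ (Σ (Fin k) λ j → i < j × t j ≡ t i)
    notLater (j , i<j , tj≡ti) = <-irrefl (sym (inj tj≡ti)) i<j

  remaining? : ∀ i → (∀ j → j < i → U.Decidable (C j)) → U.Decidable (Rem i)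
  remaining? i earlier? v =
    ¬? (any? inEarlier?) ×-dec ¬? (any? λ j → (i <? j) ×-dec (t j ≟ v))
    where
    inEarlier? : ∀ j → Dec (j < i × C j v)
    inEarlier? j with j <? i
    ... | yes j<i = map′ (j<i ,_) proj₂ (earlier? j j<i v)
    ... | no j≮i  = no (j≮i ∘ proj₁)

  part? : ∀ i → U.Decidable (C i)
  part? i = decide i (<-wellFounded i)
    where
    decide : ∀ i → Acc _<_ i → U.Decidable (C i)
    decide i (acc earlier) v =
      map′ (proj₂ (root i v)) (proj₁ (root i v))
           (walk? adj? (remaining? i (λ j j<i → decide j (earlier j<i))) (t i) v)

  covered? : U.Decidable (λ v → ∃ λ i → C i v)
  covered? v = any? λ i → part? i v

  -- A vertex adjacent to part C_j but covered by no part would lie in Rem j,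
  -- hence in C_j; so a walk to any terminal shows every vertex is covered.
  cover : Connected G → Injective _≡_ _≡_ t → Fin k → ∀ v → ∃ λ i → C i v
  cover conn inj i₀ v = decidable-stable (covered? v) λ uncovered →
    let (a , b , ¬covered-a , adj , (j , Cjb)) =
          enteringStep covered? (conn v (t i₀)) uncovered (i₀ , terminal inj i₀)
        Rem-j-a : Rem j a
        Rem-j-a = (λ (j′ , _ , Cj′a) → ¬covered-a (j′ , Cj′a))
                , (λ (j′ , _ , tj′≡a) → ¬covered-a (j′ , subst (C j′) tj′≡a (terminal inj j′)))
    in  ¬covered-a (j , Part.closed j Cjb Rem-j-a (adj-sym adj))

  isTerminalPartition : Connected G → Injective _≡_ _≡_ t → Fin k → IsTerminalPartition G t C
  isTerminalPartition conn inj i₀ =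
    cover conn inj i₀ , disjoint , Part.connected , terminal inj

lemma13 : ∀ {n k} (G : SimpleGraph n) → Connected G →
          (t : Fin k → Fin n) → Injective _≡_ _≡_ t → 1 ≤ k →
          (C : Fin k → VSet n) → IsRootFamily G t C →
          IsTerminalPartition G t C × IsMinimalMultiwayCut G t (CutEdges G C)
lemma13 G conn t inj 1≤k C root = partition , PartitionCut.isMinimal G t C partition
  where
  partition : IsTerminalPartition G t C
  partition = RootFamily.isTerminalPartition G t C root conn inj (fromℕ< 1≤k)
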